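{- Let $L$ be a layer of $A_N$ with $|L|\notin\{1,2,3,5\}$, having $m$ (nonempty) rows and $n$ columns (i.e. its first row has $n$ elements). Then there is a search procedure that, for every table $A_N$ consistent with the division poset and every real $x$, determines whether $x$ equals some element of $L$ using at most $m+n-2$ comparisons of the form $x:a$ with $a\in L$.
   Context: For $N\ge1$, a table $A_N=(a_1,\dots,a_N)$ of distinct reals is consistent with the division poset if $a_i<a_j$ whenever $i\ne j$ and $i\mid j$. A comparison $x:a_k$ returns one of $x<a_k$, $x=a_k$, $x>a_k$, and comparisons may be chosen adaptively; the searcher knows only that the table is consistent. For each $i\in\{1,\dots,N\}$ divisible by neither 2 nor 3, the layer $L_i$ is the set $\{a_{i2^k3^s}: k,s\ge 0,\ i2^k3^s\le N\}$, arranged as a two-dimensional array in which $a_{i2^k3^s}$ is placed in row $s$ and column $k$ (rows $s=0,1,\dots$ from top, columns $k=0,1,\dots$ from left). The rows are the nonempty sets $\{a_{i3^s2^k}:k\ge0\}$; the number of columns equals the number of elements of row $0$.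
   Formalization: The entries of the table $A_N$ and the searched value $x$ are rationals rather than reals. -}

module Defs where

open import Data.Nat as ℕ using (ℕ; zero; suc; _*_; _^_; _≤_; _≤?_; _∸_; _+_)
open import Data.Nat.Divisibility using (_∣_)
open import Data.Rational as ℚ using (ℚ)
open import Data.Rational.Properties using (<-cmp)
open import Data.List using (List; []; _∷_; length; filter; upTo; cartesianProduct)
open import Data.Bool using (Bool)
open import Data.Product using (_×_; _,_; ∃₂; proj₁; proj₂)
open import Relation.Binary.PropositionalEquality using (_≡_; _≢_)
open import Relation.Binary.Definitions using (tri<; tri≈; tri>)

-- A table A_N is a function a : ℕ → ℚ, of which only the entries a 1, …, a N matter.
-- Distinct entries:
Distinct : ℕ → (ℕ → ℚ) → Set
Distinct N a = ∀ p q → 1 ≤ p → p ≤ N → 1 ≤ q → q ≤ N → p ≢ q → a p ≢ a q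

Consistent : ℕ → (ℕ → ℚ) → Set
Consistent N a = ∀ p q → 1 ≤ p → p ≤ N → 1 ≤ q → q ≤ N → p ≢ q → p ∣ q → a p ℚ.< a q

InLayer : ℕ → ℕ → ℕ → Set
InLayer N i j = j ≤ N × ∃₂ λ k s → j ≡ i * 2 ^ k * 3 ^ s

-- Number of columns n of L_i = number of elements of row 0 = #{k : i 2^k ≤ N}.
-- (k ranges over 0..N, which suffices since 2^k > N for k ≥ N when i ≥ 1.)
numCols : ℕ → ℕ → ℕ
numCols N i = length (filter (λ k → i * 2 ^ k ≤? N) (upTo (suc N)))

numRows : ℕ → ℕ → ℕ
numRows N i = length (filter (λ s → i * 3 ^ s ≤? N) (upTo (suc N)))

-- |L_i| = #{(k,s) : i 2^k 3^s ≤ N}  (distinct pairs give distinct indices).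
layerSize : ℕ → ℕ → ℕ
layerSize N i =
  length (filter (λ ks → i * 2 ^ proj₁ ks * 3 ^ proj₂ ks ≤? N)
                 (cartesianProduct (upTo (suc N)) (upTo (suc N))))

-- Adaptive search procedure: a ternary decision tree. A node 'query j lt eq gt'
-- performs the comparison x : a_j and continues in the branch given by the outcome.
-- A leaf reports the answer (true = "x equals some element of L").
data Tree : Set where
  leaf  : Bool → Tree
  query : ℕ → Tree → Tree → Tree → Tree

run : Tree → (ℕ → ℚ) → ℚ → List ℕ × Bool
run (leaf b) a x = [] , b
run (query j lt eq gt) a x with <-cmp x (a j)
... | tri< _ _ _ = let r = run lt a x in (j ∷ proj₁ r) , proj₂ r
... | tri≈ _ _ _ = let r = run eq a x in (j ∷ proj₁ r) , proj₂ r
... | tri> _ _ _ = let r = run gt a x in (j ∷ proj₁ r) , proj₂ r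

{-# OPTIONS --safe #-}
module Submission where

-- Row s of the layer holds the entries a_j with j = i·3^s·2^k ≤ N, and consistency makes the
-- layer increase along rows and down columns, so saddleback search from the top-right corner
-- decides whether x occurs with m + n - 1 comparisons. One comparison is saved by comparing x
-- first with the last two entries of the current row, of length c + 2: if x is below the first,
-- two columns are discarded at the price of one comparison; if x is above the first and differs
-- from the second, the row is discarded, and since 3·2^(c+1) > 2^(c+2) the next row has at most
-- c + 1 entries, so either the same step applies to it or plain saddleback search on c columns
-- stays within budget. The step needs rows of length at least 3, and fails after a row
-- (b, 2b, 4b) lying above the row (3b, 6b); avoiding both propagates down from the top row, and
-- the top row avoids them unless |L| ∈ {1, 2, 3, 5}.

open import Defs
open import Data.Nat using (ℕ; _≤_; _∸_; _+_)
open import Data.Nat.Divisibility using (_∣_)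
open import Data.Rational using (ℚ)
open import Data.List using (length)
open import Data.List.Relation.Unary.All using (All)
open import Data.Bool using (T)
open import Data.Product using (Σ; ∃; _×_; proj₁; proj₂)
open import Relation.Nullary using (¬_)
open import Relation.Binary.PropositionalEquality using (_≡_; _≢_)
open import Function.Bundles using (_⇔_)

open import Data.Nat using (zero; suc; _*_; _^_; _<_; _≤?_; _<?_; z≤n; s≤s; NonZero; >-nonZero)
open import Data.Nat.Properties
open import Data.Nat.Divisibility using (∣⇒≤; *-pres-∣; *-monoʳ-∣; ∣-refl; 1∣_)
open import Data.Nat.ListAction using (sum)
open import Data.Nat.Tactic.RingSolver using (solve-∀)
import Data.Rational as ℚ
import Data.Rational.Properties as ℚₚ
open import Data.List using (List; []; _∷_; _++_; filter; map; upTo; applyUpTo; cartesianProduct)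
open import Data.List.Properties using (filter-++; length-++; length-map; map-cong; map-upTo)
open import Data.List.Relation.Unary.All using ([]; _∷_)
import Data.List.Relation.Unary.All as All
open import Data.Bool using (Bool; true; false)
open import Data.Unit using (tt)
open import Data.Empty using (⊥-elim)
open import Data.Product using (_,_; ∃₂)
open import Data.Sum using (inj₁; inj₂)
open import Relation.Nullary using (yes; no)
open import Relation.Unary using (Decidable)
open import Relation.Binary.PropositionalEquality using (refl; sym; trans; cong; cong₂; subst; subst₂; module ≡-Reasoning)
open import Relation.Binary.Definitions using (tri<; tri≈; tri>)
open import Function using (_∘_; id)
open import Function.Bundles using (mk⇔; Equivalence)
import Function.Properties.Equivalence as ⇔

open Equivalence using (to; from)

record ValidRun (Allowed : ℕ → Set) (Goal : Set) (budget : ℕ) (r : List ℕ × Bool) : Set where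
  field
    allowed       : All Allowed (proj₁ r)
    within-budget : length (proj₁ r) ≤ budget
    correct       : T (proj₂ r) ⇔ Goal

Decides : (ℕ → ℚ) → ℚ → (ℕ → Set) → Set → ℕ → Tree → Set
Decides a x Allowed Goal budget t = ValidRun Allowed Goal budget (run t a x)

module _ {Allowed : ℕ → Set} {Goal : Set} where

  validRun-no : ∀ {B} → ¬ Goal → ValidRun Allowed Goal B ([] , false)
  validRun-no ¬goal = record { allowed = [] ; within-budget = z≤n ; correct = mk⇔ (λ ()) ¬goal }

  validRun-yes : ∀ {B} → Goal → ValidRun Allowed Goal B ([] , true)
  validRun-yes goal = record { allowed = [] ; within-budget = z≤n ; correct = mk⇔ (λ _ → goal) (λ _ → tt) }

  validRun-mono : ∀ {B B' r} → B ≤ B' → ValidRun Allowed Goal B r → ValidRun Allowed Goal B' r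
  validRun-mono B≤B' v = record { allowed = allowed ; within-budget = ≤-trans within-budget B≤B' ; correct = correct }
    where open ValidRun v

  validRun-∷ : ∀ {B j r} → Allowed j → ValidRun Allowed Goal B r → ValidRun Allowed Goal (suc B) (j ∷ proj₁ r , proj₂ r)
  validRun-∷ allowed-j v = record { allowed = allowed-j ∷ allowed ; within-budget = s≤s within-budget ; correct = correct }
    where open ValidRun v

  decides-query : ∀ {a x B j l e g} → Allowed j →
                  (x ℚ.< a j → Decides a x Allowed Goal B l) →
                  (x ≡ a j → Decides a x Allowed Goal B e) →
                  (a j ℚ.< x → Decides a x Allowed Goal B g) →
                  Decides a x Allowed Goal (suc B) (query j l e g)
  decides-query {a} {x} {j = j} allowed-j on-lt on-eq on-gt with ℚₚ.<-cmp x (a j)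
  ... | tri< x<aj _ _ = validRun-∷ allowed-j (on-lt x<aj)
  ... | tri≈ _ x≡aj _ = validRun-∷ allowed-j (on-eq x≡aj)
  ... | tri> _ _ aj<x = validRun-∷ allowed-j (on-gt aj<x)

validRun-map : ∀ {A A' : ℕ → Set} {G G' : Set} {B B' r} → (∀ {j} → A j → A' j) → G ⇔ G' → B ≤ B' →
               ValidRun A G B r → ValidRun A' G' B' r
validRun-map A⇒A' G⇔G' B≤B' v = record
  { allowed = All.map A⇒A' allowed ; within-budget = ≤-trans within-budget B≤B' ; correct = ⇔.trans correct G⇔G' }
  where open ValidRun v

module _ {P : ℕ → Set} (P? : Decidable P) where

  length-filter-applyUpTo : ∀ L (f : ℕ → ℕ) → (∀ k → P (f (suc k)) → P (f k)) → (∀ k → P (f k) → k < L) →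
                            ∀ k → k < length (filter P? (applyUpTo f L)) ⇔ P (f k)
  length-filter-applyUpTo zero f _ bounded k = mk⇔ (λ ()) (λ p → ⊥-elim (n≮0 (bounded k p)))
  length-filter-applyUpTo (suc L) f closed bounded k
    with ih ← length-filter-applyUpTo L (f ∘ suc) (closed ∘ suc) (λ k → ≤-pred ∘ bounded (suc k)) | P? (f 0)
  ... | yes p₀ = shifted k
    where
    shifted : ∀ k → k < suc (length (filter P? (applyUpTo (f ∘ suc) L))) ⇔ P (f k)
    shifted zero    = mk⇔ (λ _ → p₀) (λ _ → s≤s z≤n)
    shifted (suc k) = mk⇔ (to (ih k) ∘ ≤-pred) (s≤s ∘ from (ih k))
  ... | no ¬p₀ = mk⇔ (λ k<n → ¬p₀-at (suc k) (to (ih k) k<n)) (¬p₀-at k)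
    where
    ¬p₀-at : ∀ {A : Set} k → P (f k) → A
    ¬p₀-at zero    p = ⊥-elim (¬p₀ p)
    ¬p₀-at (suc k) p = ¬p₀-at k (closed k p)

initial-segment-unique : ∀ {P : ℕ → Set} {m n} → (∀ k → k < m ⇔ P k) → (∀ k → k < n ⇔ P k) → m ≡ n
initial-segment-unique {m = m} {n} k<m⇔ k<n⇔ = ≤-antisym
  (≮⇒≥ λ n<m → n≮n n (from (k<n⇔ n) (to (k<m⇔ n) n<m)))
  (≮⇒≥ λ m<n → n≮n m (from (k<m⇔ m) (to (k<n⇔ m) m<n)))

n<2^n : ∀ n → n < 2 ^ n
n<2^n zero    = s≤s z≤n
n<2^n (suc n) = ≤-<-trans (n<2^n n)
  (<-≤-trans (m<m+n (2 ^ n) (m^n>0 2 n)) (≤-reflexive (cong (2 ^ n +_) (sym (+-identityʳ (2 ^ n))))))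

powersBelow : ℕ → ℕ → ℕ → ℕ
powersBelow N b q = length (filter (λ k → b * q ^ k ≤? N) (upTo (suc N)))

module _ {b q : ℕ} (1≤b : 1 ≤ b) (2≤q : 2 ≤ q) where

  powersBelow-spec : ∀ N k → k < powersBelow N b q ⇔ b * q ^ k ≤ N
  powersBelow-spec N = length-filter-applyUpTo (λ k → b * q ^ k ≤? N) (suc N) id shorter bounded
    where
    instance
      _ : NonZero b
      _ = >-nonZero 1≤b
      _ : NonZero q
      _ = >-nonZero (≤-trans (s≤s z≤n) 2≤q)
    shorter : ∀ k → b * q ^ suc k ≤ N → b * q ^ k ≤ N
    shorter k = ≤-trans (*-monoʳ-≤ b (m≤n*m (q ^ k) q))
    bounded : ∀ k → b * q ^ k ≤ N → k < suc N
    bounded k bq^k≤N = s≤s (<⇒≤ (<-≤-trans (n<2^n k)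
      (≤-trans (^-monoˡ-≤ k 2≤q) (≤-trans (m≤n*m (q ^ k) b) bq^k≤N))))

  powersBelow-zero : ∀ {N} → N < b → powersBelow N b q ≡ 0
  powersBelow-zero {N} N<b = n≤0⇒n≡0 (≮⇒≥ λ 0<n →
    <⇒≱ N<b (subst (_≤ N) (*-identityʳ b) (to (powersBelow-spec N 0) 0<n)))

powersBelow-antitone : ∀ {N b b' q} → 1 ≤ b → 2 ≤ q → b ≤ b' → powersBelow N b' q ≤ powersBelow N b q
powersBelow-antitone {N} {b} {b'} {q} 1≤b 2≤q b≤b' = ≮⇒≥ λ n<n' →
  n≮n n (from (powersBelow-spec 1≤b 2≤q N n)
          (≤-trans (*-monoˡ-≤ (q ^ n) b≤b') (to (powersBelow-spec (≤-trans 1≤b b≤b') 2≤q N n) n<n')))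
  where
  n : ℕ
  n = powersBelow N b q

scale-≤ : ∀ {N i t u} → i * t ≤ N → N < i * suc t → i * u ≤ N ⇔ u ≤ t
scale-≤ {i = i} it≤N N<i[1+t] = mk⇔
  (λ iu≤N → ≮⇒≥ λ t<u → <⇒≱ N<i[1+t] (≤-trans (*-monoʳ-≤ i t<u) iu≤N))
  (λ u≤t → ≤-trans (*-monoʳ-≤ i u≤t) it≤N)

powersBelow-scale : ∀ {N i t b q} → 1 ≤ i → 1 ≤ b → 2 ≤ q → i * t ≤ N → N < i * suc t →
                    powersBelow N (i * b) q ≡ powersBelow t b q
powersBelow-scale {N} {i} {t} {b} {q} 1≤i 1≤b 2≤q it≤N N<i[1+t] =
  initial-segment-unique scaled (powersBelow-spec 1≤b 2≤q t)
  where
  scaled : ∀ k → k < powersBelow N (i * b) q ⇔ b * q ^ k ≤ t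
  scaled k = ⇔.trans (powersBelow-spec (*-mono-≤ 1≤i 1≤b) 2≤q N k)
    (subst (λ j → j ≤ N ⇔ b * q ^ k ≤ t) (sym (*-assoc i b (q ^ k))) (scale-≤ {N} {i} {t} it≤N N<i[1+t]))

module _ {A B : Set} {P : A → Set} (P? : Decidable P) where

  filter-map : ∀ (f : B → A) ys → filter P? (map f ys) ≡ map f (filter (P? ∘ f) ys)
  filter-map f []       = refl
  filter-map f (y ∷ ys) with P? (f y)
  ... | yes _ = cong (f y ∷_) (filter-map f ys)
  ... | no  _ = filter-map f ys

module _ {A B : Set} {Q : A × B → Set} (Q? : Decidable Q) where

  length-filter-cartesianProduct : ∀ xs ys → length (filter Q? (cartesianProduct xs ys)) ≡
                                   sum (map (λ x → length (filter (λ y → Q? (x , y)) ys)) xs)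
  length-filter-cartesianProduct []       ys = refl
  length-filter-cartesianProduct (x ∷ xs) ys = begin
    length (filter Q? (map (x ,_) ys ++ cartesianProduct xs ys))
      ≡⟨ cong length (filter-++ Q? (map (x ,_) ys) (cartesianProduct xs ys)) ⟩
    length (filter Q? (map (x ,_) ys) ++ filter Q? (cartesianProduct xs ys))
      ≡⟨ length-++ (filter Q? (map (x ,_) ys)) ⟩
    length (filter Q? (map (x ,_) ys)) + length (filter Q? (cartesianProduct xs ys))
      ≡⟨ cong₂ _+_ (trans (cong length (filter-map Q? (x ,_) ys)) (length-map (x ,_) (filter (Q? ∘ (x ,_)) ys)))
                   (length-filter-cartesianProduct xs ys) ⟩
    length (filter (λ y → Q? (x , y)) ys) + sum (map (λ x → length (filter (λ y → Q? (x , y)) ys)) xs) ∎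
    where open ≡-Reasoning

sum-applyUpTo-vanishing : ∀ (g : ℕ → ℕ) {t L} → t ≤ L → (∀ k → t ≤ k → g k ≡ 0) →
                          sum (applyUpTo g L) ≡ sum (applyUpTo g t)
sum-applyUpTo-vanishing g {zero}  {zero}  _         _        = refl
sum-applyUpTo-vanishing g {zero}  {suc L} _         g≥t≡0 =
  cong₂ _+_ (g≥t≡0 0 z≤n) (sum-applyUpTo-vanishing (g ∘ suc) {zero} {L} z≤n (λ k _ → g≥t≡0 (suc k) z≤n))
sum-applyUpTo-vanishing g {suc t} {suc L} (s≤s t≤L) g≥t≡0 =
  cong (g 0 +_) (sum-applyUpTo-vanishing (g ∘ suc) t≤L (λ k t≤k → g≥t≡0 (suc k) (s≤s t≤k)))

layerSize-columns : ∀ N i → layerSize N i ≡ sum (map (λ k → powersBelow N (i * 2 ^ k) 3) (upTo (suc N)))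
layerSize-columns N i =
  length-filter-cartesianProduct (λ (k , s) → i * 2 ^ k * 3 ^ s ≤? N) (upTo (suc N)) (upTo (suc N))

layerSize-scale : ∀ {N i t} → 1 ≤ i → i * t ≤ N → N < i * suc t → layerSize N i ≡ layerSize t 1
layerSize-scale {N} {i} {t} 1≤i it≤N N<i[1+t] = begin
  layerSize N i                                               ≡⟨ layerSize-columns N i ⟩
  sum (map (λ k → powersBelow N (i * 2 ^ k) 3) (upTo (suc N))) ≡⟨ cong sum (map-cong column-scale (upTo (suc N))) ⟩
  sum (map column (upTo (suc N)))                             ≡⟨ cong sum (map-upTo column (suc N)) ⟩
  sum (applyUpTo column (suc N))                              ≡⟨ sum-applyUpTo-vanishing column (s≤s t≤N) column-vanishes ⟩
  sum (applyUpTo column (suc t))                              ≡⟨ cong sum (map-upTo column (suc t)) ⟨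
  sum (map column (upTo (suc t)))                             ≡⟨ layerSize-columns t 1 ⟨
  layerSize t 1                                               ∎
  where
  open ≡-Reasoning
  instance
    _ : NonZero i
    _ = >-nonZero 1≤i
  column : ℕ → ℕ
  column k = powersBelow t (1 * 2 ^ k) 3
  1≤2^k : ∀ k → 1 ≤ 1 * 2 ^ k
  1≤2^k k = subst (1 ≤_) (sym (*-identityˡ (2 ^ k))) (m^n>0 2 k)
  column-scale : ∀ k → powersBelow N (i * 2 ^ k) 3 ≡ column k
  column-scale k = trans (cong (λ b → powersBelow N (i * b) 3) (sym (*-identityˡ (2 ^ k))))
                         (powersBelow-scale 1≤i (1≤2^k k) (s≤s (s≤s z≤n)) it≤N N<i[1+t])
  column-vanishes : ∀ k → suc t ≤ k → column k ≡ 0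
  column-vanishes k t<k = powersBelow-zero (1≤2^k k) (s≤s (s≤s z≤n))
    (<-≤-trans (<-trans t<k (n<2^n k)) (≤-reflexive (sym (*-identityˡ (2 ^ k)))))
  t≤N : t ≤ N
  t≤N = ≤-trans (m≤n*m t i) it≤N

-- The row b, 2b, 4b, … of entries ≤ N has at least three entries, and is not the
-- row (b, 2b, 4b) above the row (3b, 6b).
WideRow : ℕ → ℕ → Set
WideRow N b = b * 4 ≤ N × ¬ (b * 6 ≤ N × N < b * 8)

b*2^[2+k]≤3*b*2^[1+k] : ∀ b k → b * 2 ^ (2 + k) ≤ 3 * b * 2 ^ (1 + k)
b*2^[2+k]≤3*b*2^[1+k] b k = subst₂ _≤_ (sym (lhs b (2 ^ k))) (sym (rhs b (2 ^ k))) (*-monoˡ-≤ (b * 2 ^ k) (m≤m+n 4 2))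
  where
  lhs : ∀ m t → m * (2 * (2 * t)) ≡ 4 * (m * t)
  lhs = solve-∀
  rhs : ∀ m t → 3 * m * (2 * t) ≡ 6 * (m * t)
  rhs = solve-∀

module _ {N b : ℕ} (1≤b : 1 ≤ b) where

  private
    row : ∀ k → k < powersBelow N b 2 ⇔ b * 2 ^ k ≤ N
    row = powersBelow-spec 1≤b ≤-refl N
    row₃ : ∀ k → k < powersBelow N (3 * b) 2 ⇔ 3 * b * 2 ^ k ≤ N
    row₃ = powersBelow-spec (≤-trans 1≤b (m≤n*m b 3)) ≤-refl N

  wideRow⇒3≤ : WideRow N b → 3 ≤ powersBelow N b 2
  wideRow⇒3≤ (b*4≤N , _) = from (row 2) b*4≤N

  wideRow-next : ∀ {c} → WideRow N b → powersBelow N b 2 ≡ 2 + c → c < powersBelow N (3 * b) 2 →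
                 powersBelow N (3 * b) 2 ≡ 1 + c × WideRow N (3 * b)
  wideRow-next {zero} wide r≡2 _ = ⊥-elim (n≮n 2 (subst (2 <_) r≡2 (wideRow⇒3≤ wide)))
  wideRow-next {suc zero} (_ , ¬b*6≤N<b*8) r≡3 1<r₃ = ⊥-elim (¬b*6≤N<b*8 (b*6≤N , N<b*8))
    where
    b*6≤N : b * 6 ≤ N
    b*6≤N = subst (_≤ N) (3*m*2≡m*6 b) (to (row₃ 1) 1<r₃)
      where
      3*m*2≡m*6 : ∀ m → 3 * m * 2 ≡ m * 6
      3*m*2≡m*6 = solve-∀
    N<b*8 : N < b * 8
    N<b*8 = ≰⇒> λ b*8≤N → n≮n 3 (subst (3 <_) r≡3 (from (row 3) b*8≤N))
  wideRow-next {suc (suc c)} _ r≡4+c 2+c<r₃ = r₃≡3+c , b*12≤N , ¬b*18≤N<b*24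
    where
    r₃≤3+c : powersBelow N (3 * b) 2 ≤ 3 + c
    r₃≤3+c = ≮⇒≥ λ 3+c<r₃ → n≮n (4 + c) (subst (4 + c <_) r≡4+c
      (from (row (4 + c)) (≤-trans (b*2^[2+k]≤3*b*2^[1+k] b (2 + c)) (to (row₃ (3 + c)) 3+c<r₃))))
    r₃≡3+c : powersBelow N (3 * b) 2 ≡ 3 + c
    r₃≡3+c = ≤-antisym r₃≤3+c 2+c<r₃
    b*12≤N : 3 * b * 4 ≤ N
    b*12≤N = to (row₃ 2) (≤-trans (m≤m+n 3 c) 2+c<r₃)
    ¬b*18≤N<b*24 : ¬ (3 * b * 6 ≤ N × N < 3 * b * 8)
    ¬b*18≤N<b*24 (b*18≤N , N<b*24) = <⇒≱ N<b*24 (to (row₃ 3) 3<r₃)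
      where
      b*16≤b*18 : b * 16 ≤ 3 * b * 6
      b*16≤b*18 = subst (b * 16 ≤_) (m*18≡3*m*6 b) (*-monoʳ-≤ b (m≤m+n 16 2))
        where
        m*18≡3*m*6 : ∀ m → m * 18 ≡ 3 * m * 6
        m*18≡3*m*6 = solve-∀
      3<r₃ : 3 < powersBelow N (3 * b) 2
      3<r₃ = ≤-pred (subst (4 <_) (trans r≡4+c (cong suc (sym r₃≡3+c)))
        (from (row 4) (≤-trans b*16≤b*18 b*18≤N)))

wideRow-layer : ∀ {N i} → 1 ≤ i → i ≤ N →
                layerSize N i ≢ 1 → layerSize N i ≢ 2 → layerSize N i ≢ 3 → layerSize N i ≢ 5 → WideRow N i
wideRow-layer {N} {i} 1≤i i≤N ≢1 ≢2 ≢3 ≢5 = i*4≤N , ¬i*6≤N<i*8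
  where
  -- layerSize t 1 evaluates to 1, 2, 3, 5, 5 for t = 1, 2, 3, 6, 7.
  size : ∀ t → i * t ≤ N → N < i * suc t → layerSize N i ≡ layerSize t 1
  size t = layerSize-scale 1≤i
  i*4≤N : i * 4 ≤ N
  i*4≤N with i * 4 ≤? N | i * 3 ≤? N | i * 2 ≤? N
  ... | yes i*4≤N | _         | _         = i*4≤N
  ... | no  i*4≰N | yes i*3≤N | _         = ⊥-elim (≢3 (size 3 i*3≤N (≰⇒> i*4≰N)))
  ... | no  _     | no  i*3≰N | yes i*2≤N = ⊥-elim (≢2 (size 2 i*2≤N (≰⇒> i*3≰N)))
  ... | no  _     | no  _     | no  i*2≰N =
    ⊥-elim (≢1 (size 1 (subst (_≤ N) (sym (*-identityʳ i)) i≤N) (≰⇒> i*2≰N)))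
  ¬i*6≤N<i*8 : ¬ (i * 6 ≤ N × N < i * 8)
  ¬i*6≤N<i*8 (i*6≤N , N<i*8) with i * 7 ≤? N
  ... | yes i*7≤N = ≢5 (size 7 i*7≤N N<i*8)
  ... | no  i*7≰N = ≢5 (size 6 i*6≤N (≰⇒> i*7≰N))

module Staircase (cell : ℕ → ℕ → ℕ) (rowLen : ℕ → ℕ) where

  IsCell : ℕ → Set
  IsCell j = ∃₂ λ s k → k < rowLen s × cell s k ≡ j

  Occurs : (ℕ → ℚ) → ℚ → Set
  Occurs a x = ∃₂ λ s k → k < rowLen s × a (cell s k) ≡ x

  -- Saddleback search of the rows s, …, s + d - 1 restricted to the columns < c.
  saddleback : ℕ → ℕ → ℕ → Tree
  saddleback s zero    c       = leaf false
  saddleback s (suc d) zero    = leaf false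
  saddleback s (suc d) (suc c) with c <? rowLen s
  ... | yes _ = query (cell s c) (saddleback s (suc d) c) (leaf true) (saddleback (suc s) d (suc c))
  ... | no  _ = saddleback s (suc d) c

  mutual
    search : ℕ → ℕ → Tree
    search s zero    = leaf false
    search s (suc d) = searchRow s d (rowLen s)

    searchRow : ℕ → ℕ → ℕ → Tree
    searchRow s d (suc (suc c)) =
      query (cell s c) (saddleback s (suc d) c) (leaf true)
            (query (cell s (suc c)) (searchBelow s d c) (leaf true) (searchBelow s d c))
    searchRow s d n = saddleback s (suc d) n

    searchBelow : ℕ → ℕ → ℕ → Tree
    searchBelow s d c with rowLen (suc s) ≤? c
    ... | yes _ = saddleback (suc s) d c
    ... | no  _ = search (suc s) d

  module Decision (rowLen-antitone : ∀ {s s'} → s ≤ s' → rowLen s' ≤ rowLen s)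
                  (a : ℕ → ℚ) (x : ℚ)
                  (monotone : ∀ {s k s' k'} → s ≤ s' → k ≤ k' → k' < rowLen s' → a (cell s k) ℚ.≤ a (cell s' k'))
                  where

    DecidesOccurs : ℕ → Tree → Set
    DecidesOccurs = Decides a x IsCell (Occurs a x)

    Within : ℕ → ℕ → Set
    Within s c = ∀ {s' k} → k < rowLen s' → a (cell s' k) ≡ x → s ≤ s' × k < c

    within-top : Within 0 (rowLen 0)
    within-top k<r _ = z≤n , ≤-trans k<r (rowLen-antitone z≤n)

    within-narrow : ∀ {s c c'} → rowLen s ≤ c → Within s c' → Within s c
    within-narrow r≤c w k<r ak≡x with w k<r ak≡x
    ... | s≤s' , _ = s≤s' , ≤-trans k<r (≤-trans (rowLen-antitone s≤s') r≤c)

    within-left : ∀ {s c c'} → x ℚ.< a (cell s c) → Within s c' → Within s c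
    within-left x<a w k<r ak≡x with w k<r ak≡x
    ... | s≤s' , _ = s≤s' , ≰⇒> λ c≤k →
      ℚₚ.<-irrefl (sym ak≡x) (ℚₚ.<-≤-trans x<a (monotone s≤s' c≤k k<r))

    within-down : ∀ {s c} → (∀ {k} → k < c → a (cell s k) ≢ x) → Within s c → Within (suc s) c
    within-down excluded w k<r ak≡x with w k<r ak≡x
    ... | s≤s' , k<c with m≤n⇒m<n∨m≡n s≤s'
    ...   | inj₁ s<s' = s<s' , k<c
    ...   | inj₂ refl = ⊥-elim (excluded k<c ak≡x)

    left-of-smaller : ∀ {s c} → c < rowLen s → a (cell s c) ℚ.< x → ∀ {k} → k < suc c → a (cell s k) ≢ x
    left-of-smaller c<r a<x k≤c ak≡x = ℚₚ.<-irrefl ak≡x (ℚₚ.≤-<-trans (monotone ≤-refl (≤-pred k≤c) c<r) a<x)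

    within-0⇒¬Occurs : ∀ {s} → Within s 0 → ¬ Occurs a x
    within-0⇒¬Occurs w (_ , _ , k<r , ak≡x) = n≮0 (proj₂ (w k<r ak≡x))

    empty⇒¬Occurs : ∀ {s c} → rowLen s ≡ 0 → Within s c → ¬ Occurs a x
    empty⇒¬Occurs r≡0 w = within-0⇒¬Occurs (within-narrow (≤-reflexive r≡0) w)

    empty-below : ∀ d s → rowLen (suc d + s) ≡ 0 → rowLen (d + suc s) ≡ 0
    empty-below d s = trans (cong rowLen (+-suc d s))

    saddleback-decides : ∀ s d c → rowLen (d + s) ≡ 0 → Within s c → DecidesOccurs (d + c ∸ 1) (saddleback s d c)
    saddleback-decides s zero    c       empty w = validRun-no (empty⇒¬Occurs empty w)
    saddleback-decides s (suc d) zero    _     w = validRun-no (within-0⇒¬Occurs w)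
    saddleback-decides s (suc d) (suc c) empty w with c <? rowLen s
    ... | yes c<r = validRun-mono (≤-reflexive (sym (+-suc d c))) (decides-query (s , c , c<r , refl)
          (λ x<a → saddleback-decides s (suc d) c empty (within-left x<a w))
          (λ x≡a → validRun-yes (s , c , c<r , sym x≡a))
          (λ a<x → validRun-mono (≤-reflexive (cong (_∸ 1) (+-suc d c)))
                     (saddleback-decides (suc s) d (suc c) (empty-below d s empty)
                                         (within-down (left-of-smaller c<r a<x) w))))
    ... | no c≮r = validRun-mono (+-monoʳ-≤ d (n≤1+n c))
                     (saddleback-decides s (suc d) c empty (within-narrow (≮⇒≥ c≮r) w))

    module Search (Wide : ℕ → Set)
                  (wide⇒3≤rowLen : ∀ s → Wide s → 3 ≤ rowLen s)
                  (wide-next : ∀ s {c} → Wide s → rowLen s ≡ 2 + c → c < rowLen (suc s) →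
                               rowLen (suc s) ≡ 1 + c × Wide (suc s))
                  where
      mutual
        search-decides : ∀ s d → Wide s → rowLen (d + s) ≡ 0 → Within s (rowLen s) →
                         DecidesOccurs (d + rowLen s ∸ 2) (search s d)
        search-decides s zero    _    empty w = validRun-no (empty⇒¬Occurs empty w)
        search-decides s (suc d) wide empty w = searchRow-decides s d (rowLen s) (wide⇒3≤rowLen s wide) refl wide empty w

        searchRow-decides : ∀ s d n → 3 ≤ n → rowLen s ≡ n → Wide s → rowLen (suc d + s) ≡ 0 → Within s n →
                            DecidesOccurs (suc d + n ∸ 2) (searchRow s d n)
        searchRow-decides s d (suc (suc (suc c))) _ r≡3+c wide empty w =
          validRun-mono (≤-reflexive budget) (decides-query (s , suc c , 1+c<r , refl)
            (λ x<a → saddleback-decides s (suc d) (suc c) empty (within-left x<a w))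
            (λ x≡a → validRun-yes (s , suc c , 1+c<r , sym x≡a))
            (λ a<x → validRun-mono (≤-reflexive (sym (+-suc d c))) (decides-query (s , suc (suc c) , 2+c<r , refl)
              (λ x<a' → below a<x (λ x≡a' → ℚₚ.<-irrefl x≡a' x<a'))
              (λ x≡a' → validRun-yes (s , suc (suc c) , 2+c<r , sym x≡a'))
              (λ a'<x → below a<x (λ x≡a' → ℚₚ.<-irrefl (sym x≡a') a'<x)))))
          where
          2+c<r : 2 + c < rowLen s
          2+c<r = ≤-reflexive (sym r≡3+c)
          1+c<r : 1 + c < rowLen s
          1+c<r = <-trans (n<1+n (suc c)) 2+c<r
          budget : suc (d + suc c) ≡ suc d + (3 + c) ∸ 2
          budget = sym (trans (cong (_∸ 1) (+-suc d (2 + c))) (+-suc d (suc c)))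
          below : a (cell s (suc c)) ℚ.< x → x ≢ a (cell s (2 + c)) → DecidesOccurs (d + c) (searchBelow s d (suc c))
          below a<x x≢a' = validRun-mono (≤-reflexive (cong (_∸ 1) (+-suc d c)))
            (searchBelow-decides s d (suc c) r≡3+c wide (empty-below d s empty) (within-down excluded w))
            where
            excluded : ∀ {k} → k < 3 + c → a (cell s k) ≢ x
            excluded k<3+c with m≤n⇒m<n∨m≡n (≤-pred k<3+c)
            ... | inj₁ k<2+c = left-of-smaller 1+c<r a<x k<2+c
            ... | inj₂ refl  = x≢a' ∘ sym
        searchRow-decides s d zero                () _ _ _ _
        searchRow-decides s d (suc zero)          (s≤s ()) _ _ _ _
        searchRow-decides s d (suc (suc zero))    (s≤s (s≤s ())) _ _ _ _

        searchBelow-decides : ∀ s d c → rowLen s ≡ 2 + c → Wide s → rowLen (d + suc s) ≡ 0 → Within (suc s) (2 + c) →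
                              DecidesOccurs (d + c ∸ 1) (searchBelow s d c)
        searchBelow-decides s d c r≡2+c wide empty w with rowLen (suc s) ≤? c
        ... | yes r'≤c = saddleback-decides (suc s) d c empty (within-narrow r'≤c w)
        ... | no  r'≰c = validRun-mono (≤-reflexive budget)
                           (search-decides (suc s) d (proj₂ next) empty (within-narrow ≤-refl w))
          where
          next : rowLen (suc s) ≡ 1 + c × Wide (suc s)
          next = wide-next s wide r≡2+c (≰⇒> r'≰c)
          budget : d + rowLen (suc s) ∸ 2 ≡ d + c ∸ 1
          budget = trans (cong (λ r → d + r ∸ 2) (proj₁ next)) (cong (_∸ 2) (+-suc d c))

^-monoʳ-∣ : ∀ q {m n} → m ≤ n → q ^ m ∣ q ^ n
^-monoʳ-∣ q {n = n} z≤n   = 1∣ (q ^ n)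
^-monoʳ-∣ q       (s≤s m≤n) = *-monoʳ-∣ q (^-monoʳ-∣ q m≤n)

module Layer (N i : ℕ) (1≤i : 1 ≤ i) where

  cell : ℕ → ℕ → ℕ
  cell s k = i * 2 ^ k * 3 ^ s

  rowLen : ℕ → ℕ
  rowLen s = powersBelow N (i * 3 ^ s) 2

  open Staircase cell rowLen public

  1≤i*3^s : ∀ s → 1 ≤ i * 3 ^ s
  1≤i*3^s s = *-mono-≤ 1≤i (m^n>0 3 s)

  rowLen-spec : ∀ s k → k < rowLen s ⇔ cell s k ≤ N
  rowLen-spec s k = subst (λ j → k < rowLen s ⇔ j ≤ N) (swap i (3 ^ s) (2 ^ k))
                          (powersBelow-spec (1≤i*3^s s) ≤-refl N k)
    where
    swap : ∀ i u v → i * u * v ≡ i * v * u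
    swap = solve-∀

  rowLen-antitone : ∀ {s s'} → s ≤ s' → rowLen s' ≤ rowLen s
  rowLen-antitone {s} s≤s' = powersBelow-antitone (1≤i*3^s s) ≤-refl (*-monoʳ-≤ i (^-monoʳ-≤ 3 s≤s'))

  rowLen-numRows : rowLen (numRows N i) ≡ 0
  rowLen-numRows = powersBelow-zero (1≤i*3^s m) ≤-refl
    (≰⇒> λ i*3^m≤N → n≮n m (from (powersBelow-spec 1≤i (s≤s (s≤s z≤n)) N m) i*3^m≤N))
    where
    m : ℕ
    m = numRows N i

  cell-∣ : ∀ {s k s' k'} → s ≤ s' → k ≤ k' → cell s k ∣ cell s' k'
  cell-∣ s≤s' k≤k' = *-pres-∣ (*-pres-∣ (∣-refl {i}) (^-monoʳ-∣ 2 k≤k')) (^-monoʳ-∣ 3 s≤s')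

  1≤cell : ∀ s k → 1 ≤ cell s k
  1≤cell s k = *-mono-≤ (*-mono-≤ 1≤i (m^n>0 2 k)) (m^n>0 3 s)

  monotone : ∀ {a} → Consistent N a →
             ∀ {s k s' k'} → s ≤ s' → k ≤ k' → k' < rowLen s' → a (cell s k) ℚ.≤ a (cell s' k')
  monotone {a} consistent {s} {k} {s'} {k'} s≤s' k≤k' k'<r with cell s k ≟ cell s' k'
  ... | yes same = ℚₚ.≤-reflexive (cong a same)
  ... | no differ = ℚₚ.<⇒≤
    (consistent _ _ (1≤cell s k) (≤-trans (∣⇒≤ divides) cell'≤N) (1≤cell s' k') cell'≤N differ divides)
    where
    instance
      _ : NonZero (cell s' k')
      _ = >-nonZero (1≤cell s' k')
    divides : cell s k ∣ cell s' k'
    divides = cell-∣ s≤s' k≤k'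
    cell'≤N : cell s' k' ≤ N
    cell'≤N = to (rowLen-spec s' k') k'<r

  Wide : ℕ → Set
  Wide s = WideRow N (i * 3 ^ s)

  wide⇒3≤rowLen : ∀ s → Wide s → 3 ≤ rowLen s
  wide⇒3≤rowLen s = wideRow⇒3≤ (1≤i*3^s s)

  wide-next : ∀ s {c} → Wide s → rowLen s ≡ 2 + c → c < rowLen (suc s) → rowLen (suc s) ≡ 1 + c × Wide (suc s)
  wide-next s {c} wide r≡2+c =
    subst (λ b → c < powersBelow N b 2 → powersBelow N b 2 ≡ 1 + c × WideRow N b) (3*[i*t]≡i*[3*t] i (3 ^ s))
          (wideRow-next (1≤i*3^s s) wide r≡2+c)
    where
    3*[i*t]≡i*[3*t] : ∀ i t → 3 * (i * t) ≡ i * (3 * t)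
    3*[i*t]≡i*[3*t] = solve-∀

  isCell⇒inLayer : ∀ {j} → IsCell j → InLayer N i j
  isCell⇒inLayer (s , k , k<r , refl) = to (rowLen-spec s k) k<r , k , s , refl

  occurs⇔ : ∀ a x → Occurs a x ⇔ ∃ λ j → InLayer N i j × a j ≡ x
  occurs⇔ a x = mk⇔
    (λ (s , k , k<r , ak≡x) → cell s k , isCell⇒inLayer (s , k , k<r , refl) , ak≡x)
    (λ { (j , (j≤N , k , s , refl) , aj≡x) → s , k , from (rowLen-spec s k) j≤N , aj≡x })

  layer-search : Wide 0 → ∀ a → Consistent N a → ∀ x →
                 Decides a x (InLayer N i) (∃ λ j → InLayer N i j × a j ≡ x)
                         (numRows N i + numCols N i ∸ 2) (search 0 (numRows N i))
  layer-search wide a consistent x =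
    validRun-map isCell⇒inLayer (occurs⇔ a x) (≤-reflexive (cong (λ b → m + powersBelow N b 2 ∸ 2) (*-identityʳ i)))
      (search-decides 0 m wide (trans (cong rowLen (+-identityʳ m)) rowLen-numRows) within-top)
    where
    m : ℕ
    m = numRows N i
    open Decision rowLen-antitone a x (monotone consistent)
    open Search Wide wide⇒3≤rowLen wide-next

-- Consistency alone makes the layer monotone.
lemma4p1 : (N i : ℕ) → 1 ≤ i → i ≤ N → ¬ (2 ∣ i) → ¬ (3 ∣ i) →
    layerSize N i ≢ 1 → layerSize N i ≢ 2 → layerSize N i ≢ 3 → layerSize N i ≢ 5 →
    Σ Tree λ t → (a : ℕ → ℚ) → Distinct N a → Consistent N a → (x : ℚ) →
      All (InLayer N i) (proj₁ (run t a x))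
      × length (proj₁ (run t a x)) ≤ numRows N i + numCols N i ∸ 2
      × (T (proj₂ (run t a x)) ⇔ ∃ λ j → InLayer N i j × a j ≡ x)
lemma4p1 N i 1≤i i≤N _ _ ≢1 ≢2 ≢3 ≢5 = search 0 (numRows N i) , λ a _ consistent x →
  let open ValidRun (layer-search wide a consistent x) in allowed , within-budget , correct
  where
  open Layer N i 1≤i
  wide : Wide 0
  wide = subst (WideRow N) (sym (*-identityʳ i)) (wideRow-layer 1≤i i≤N ≢1 ≢2 ≢3 ≢5)
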